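{- Let $t$ be a positive integer and let $G$ be a graph on $m$ vertices containing no $K_t$-subdivision. If $G$ has minimum degree at least $\frac{9}{10}m$, then $m \le \max\{\frac{20}{11}t, \frac{t^2}{5}\}$ and $G$ is $\left(1-\frac{m}{2t^2}, \frac{20}{11}t\right)$-locally sparse.
   Context: Graphs are finite and simple. A $K_t$-subdivision in $G$ is a subgraph of $G$ obtained from a copy of $K_t$ by replacing its edges with internally vertex-disjoint paths. For real $\beta$ and $N$, a graph $G$ is $(\beta,N)$-locally sparse if every set $X$ of at least $N$ vertices of $G$ contains a vertex $v\in X$ whose degree in the induced subgraph $G[X]$ is at most $\beta|X|$. -}

module Defs where

open import Data.Nat as ℕ using (ℕ; zero; suc)
open import Data.Integer using (+_)
open import Data.Rational as ℚ using (ℚ; 0ℚ)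
open import Data.Fin using (Fin; _<_)
open import Data.Fin.Subset using (Subset; ∣_∣; _∩_; _∈_)
open import Data.Vec using (tabulate)
open import Data.List using (List; []; _∷_)
open import Data.List.Relation.Unary.Unique.Propositional using (Unique)
import Data.List.Membership.Propositional as LM
open import Data.Product using (_×_; Σ; ∃; ∃-syntax)
open import Data.Bool using (Bool)
open import Function.Definitions using (Injective)
open import Relation.Binary.PropositionalEquality using (_≡_)
open import Relation.Nullary using (¬_; Dec; does)

record Graph (m : ℕ) : Set₁ where
  field
    Adj    : Fin m → Fin m → Set
    adj?   : (u v : Fin m) → Dec (Adj u v)
    sym    : ∀ {u v} → Adj u v → Adj v u
    irrefl : ∀ {v} → ¬ Adj v v

  N : Fin m → Subset m
  N v = tabulate (λ w → does (adj? v w))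

  degree : Fin m → ℕ
  degree v = ∣ N v ∣

  degreeIn : Subset m → Fin m → ℕ
  degreeIn X v = ∣ X ∩ N v ∣

  -- Walk a xs b : a, x₁, …, x_k, b is a walk in G (xs = internal vertices)
  Walk : Fin m → List (Fin m) → Fin m → Set
  Walk a []       b = Adj a b
  Walk a (x ∷ xs) b = Adj a x × Walk x xs b

module _ {m : ℕ} (G : Graph m) where
  open Graph G

  -- A K_t-subdivision in G: t distinct branch vertices, and for each pair
  -- i < j a path from branch i to branch j (given by its list of internal
  -- vertices); paths are simple, internal vertices are not branch vertices,
  -- and different paths share no internal vertex.
  record Subdivision (t : ℕ) : Set where
    field
      branch     : Fin t → Fin m
      branch-inj : Injective _≡_ _≡_ branch
      path       : (i j : Fin t) → i < j → List (Fin m)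
      path-walk  : ∀ i j (p : i < j) → Walk (branch i) (path i j p) (branch j)
      path-uniq  : ∀ i j (p : i < j) → Unique (path i j p)
      internal-not-branch :
        ∀ i j (p : i < j) k → ¬ (branch k LM.∈ path i j p)
      disjoint :
        ∀ i j (p : i < j) k l (q : k < l) v →
          v LM.∈ path i j p → v LM.∈ path k l q → (i ≡ k × j ≡ l)

  HasSubdivision : ℕ → Set
  HasSubdivision t = Subdivision t

  LocallySparse : ℚ → ℚ → Set
  LocallySparse β Nₛ =
    (X : Subset m) → Nₛ ℚ.≤ (+ ∣ X ∣ ℚ./ 1) →
      ∃[ v ] (v ∈ X × (+ degreeIn X v ℚ./ 1) ℚ.≤ β ℚ.* (+ ∣ X ∣ ℚ./ 1))

-- n / d as a rational (with the convention n / 0 = 0; only used with d > 0)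
_over_ : ℕ → ℕ → ℚ
n over zero  = 0ℚ
n over suc d = + n ℚ./ suc d

module Submission where

-- Suppose X has |X| ≥ 20t/11 and every vertex of X has more than
-- (1 - m/(2t²))|X| neighbours in X.  Then each vertex of X misses at most
-- m|X|/(2t²) others, so X has at most m|X|²/(4t²) non-edges.  Deleting
-- vertices of maximum non-degree never raises the proportion of non-edges,
-- so X contains a t-set S with at most m/4 non-edges.  Two non-adjacent
-- vertices have at least 4m/5 + 2 common neighbours, more than the t + m/4
-- vertices used by S and the other routes, so joining every non-adjacent
-- pair of S through its own common neighbour (chosen greedily) yields a
-- K_t-subdivision; for t = 1 a single vertex suffices.  This proves local
-- sparsity.  If m > 20t/11, applying it to X = V(G) gives a vertex of degree
-- at most (1 - m/(2t²))m, which together with degree ≥ 9m/10 forces m ≤ t²/5.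

open import Defs
open import Data.Nat using (ℕ; zero; suc; _+_; _*_; _∸_; _≤_; _<_; _≤?_; z≤n; s≤s; NonZero; >-nonZero)
open import Data.Nat.Properties hiding (_≟_)
open import Data.Nat.Tactic.RingSolver using (solve-∀)
open import Data.Bool using (Bool; true; false; _∧_; _∨_; not)
open import Data.Bool.Properties using () renaming (_≟_ to _≟ᵇ_)
open import Data.Fin using (Fin; zero; suc) renaming (_<_ to _<ᶠ_; _<?_ to _<ᶠ?_)
open import Data.Fin.Properties using (_≟_; any?) renaming (<⇒≢ to <ᶠ⇒≢; <-asym to <ᶠ-asym)
open import Data.Fin.Subset using (Subset; ∣_∣; _∩_; ⊤)
open import Data.Fin.Subset.Properties using (∣p∣≤n; ∣⊤∣≡n; ∩-identityˡ)
open import Data.Vec using ([]; _∷_; lookup; tabulate)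
open import Data.Vec.Properties using (lookup-zipWith; lookup∘tabulate; lookup⇒[]=)
open import Data.List using (List; []; _∷_; _++_; map; length; filter; allFin; cartesianProduct)
  renaming (lookup to lookupₗ; tabulate to tabulateₗ)
open import Data.List.Properties using (length-++)
open import Data.List.Membership.Propositional using (_∈_; _∉_)
open import Data.List.Membership.Propositional.Properties
  using (∈-++⁺ˡ; ∈-++⁺ʳ; ∈-filter⁺; ∈-filter⁻; ∈-lookup; ∈-allFin; ∈-cartesianProduct⁺)
import Data.List.Membership.DecPropositional as DecMembership
open import Data.List.Relation.Unary.Any as Any using (here; there)
open import Data.List.Relation.Unary.All as All using (All; []; _∷_)
open import Data.List.Relation.Unary.AllPairs using ([]; _∷_)
open import Data.List.Relation.Unary.Unique.Propositional using (Unique)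
import Data.List.Relation.Unary.Unique.Propositional.Properties as Unique
open import Data.Product using (_×_; ∃-syntax; _,_; proj₁; proj₂)
open import Data.Product.Properties using (≡-dec)
open import Data.Sum using (_⊎_; inj₁; inj₂)
open import Data.Empty using (⊥-elim)
open import Function using (_∘_)
open import Relation.Nullary using (¬_; Dec; yes; no; does; ¬?; _×-dec_; contradiction)
open import Relation.Nullary.Decidable using (T?)
open import Relation.Binary.PropositionalEquality
open import Data.Rational using (1ℚ; _-_; _⊔_) renaming (_≤_ to _≤ℚ_)
import Data.Integer as ℤ
import Data.Integer.Properties as ℤ
open import Data.Integer.Tactic.RingSolver using () renaming (solve-∀ to solveℤ-∀)
import Data.Rational as ℚ
import Data.Rational.Properties as ℚ
import Data.Rational.Unnormalised as ℚᵘ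
import Data.Rational.Unnormalised.Properties as ℚᵘ
open import Algebra.Properties.Semiring.Sum +-*-semiring
  using (sum; sum-syntax; sum-cong-≗; ∑-distrib-+; ∑-comm; *-distribˡ-sum)

⟦_⟧ : Bool → ℕ
⟦ true ⟧ = 1
⟦ false ⟧ = 0

⟦∧⟧ : ∀ a b → ⟦ a ∧ b ⟧ ≡ ⟦ a ⟧ * ⟦ b ⟧
⟦∧⟧ true true = refl
⟦∧⟧ true false = refl
⟦∧⟧ false b = refl

sum-mono : ∀ {n} {f g : Fin n → ℕ} → (∀ i → f i ≤ g i) → sum f ≤ sum g
sum-mono {zero} f≤g = z≤n
sum-mono {suc n} f≤g = +-mono-≤ (f≤g zero) (sum-mono (f≤g ∘ suc))

sum-const : ∀ n c → ∑[ i < n ] c ≡ n * c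
sum-const zero c = refl
sum-const (suc n) c = cong (c +_) (sum-const n c)

sum-point : ∀ {n} (u : Fin n) (g : Fin n → ℕ) → ∑[ v < n ] (⟦ does (v ≟ u) ⟧ * g v) ≡ g u
sum-point {suc n} zero g = begin
  g zero + 0 + ∑[ i < n ] 0 ≡⟨ cong (g zero + 0 +_) (trans (sum-const n 0) (*-zeroʳ n)) ⟩
  g zero + 0 + 0            ≡⟨ trans (+-identityʳ _) (+-identityʳ _) ⟩
  g zero                    ∎
  where open ≡-Reasoning
sum-point {suc n} (suc u) g = sum-point u (g ∘ suc)

count-point : ∀ {n} (u : Fin n) → ∑[ v < n ] ⟦ does (v ≟ u) ⟧ ≡ 1
count-point u = trans (sum-cong-≗ λ v → sym (*-identityʳ ⟦ does (v ≟ u) ⟧)) (sum-point u (λ _ → 1))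

sum-below-diagonal : ∀ {n} (f : Fin n → Fin n → ℕ) → (∀ i j → f i j ≡ f j i) →
  let half = ∑[ i < n ] ∑[ j < n ] (⟦ does (i <ᶠ? j) ⟧ * f i j) in
  half + half ≤ ∑[ i < n ] ∑[ j < n ] f i j
sum-below-diagonal {n} f f-sym = begin
  half + half
    ≡⟨ cong (half +_) (trans (sum-cong-≗ λ i → sum-cong-≗ λ j → cong (⟦ does (i <ᶠ? j) ⟧ *_) (f-sym i j))
                         (∑-comm (λ i j → ⟦ does (i <ᶠ? j) ⟧ * f j i))) ⟩
  half + ∑[ i < n ] ∑[ j < n ] (⟦ does (j <ᶠ? i) ⟧ * f i j)
    ≡⟨ ∑-distrib-+ (λ i → ∑[ j < n ] (⟦ does (i <ᶠ? j) ⟧ * f i j)) _ ⟨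
  ∑[ i < n ] (∑[ j < n ] (⟦ does (i <ᶠ? j) ⟧ * f i j) + ∑[ j < n ] (⟦ does (j <ᶠ? i) ⟧ * f i j))
    ≡⟨ sum-cong-≗ (λ i → ∑-distrib-+ (λ j → ⟦ does (i <ᶠ? j) ⟧ * f i j) _) ⟨
  ∑[ i < n ] ∑[ j < n ] (⟦ does (i <ᶠ? j) ⟧ * f i j + ⟦ does (j <ᶠ? i) ⟧ * f i j)
    ≤⟨ sum-mono (λ i → sum-mono (λ j → termwise i j)) ⟩
  ∑[ i < n ] ∑[ j < n ] f i j ∎
  where
  open ≤-Reasoning
  half = ∑[ i < n ] ∑[ j < n ] (⟦ does (i <ᶠ? j) ⟧ * f i j)
  exclusive : {A B : Set} (a : Dec A) (b : Dec B) → (A → ¬ B) → ⟦ does a ⟧ + ⟦ does b ⟧ ≤ 1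
  exclusive (yes a) (yes b) a⇒¬b = contradiction b (a⇒¬b a)
  exclusive (yes _) (no _) _ = ≤-refl
  exclusive (no _) (yes _) _ = ≤-refl
  exclusive (no _) (no _) _ = z≤n
  at-most-one : ∀ i j → ⟦ does (i <ᶠ? j) ⟧ + ⟦ does (j <ᶠ? i) ⟧ ≤ 1
  at-most-one i j = exclusive (i <ᶠ? j) (j <ᶠ? i) <ᶠ-asym
  termwise : ∀ i j → ⟦ does (i <ᶠ? j) ⟧ * f i j + ⟦ does (j <ᶠ? i) ⟧ * f i j ≤ f i j
  termwise i j = begin
    ⟦ does (i <ᶠ? j) ⟧ * f i j + ⟦ does (j <ᶠ? i) ⟧ * f i j ≡⟨ *-distribʳ-+ (f i j) ⟦ does (i <ᶠ? j) ⟧ ⟦ does (j <ᶠ? i) ⟧ ⟨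
    (⟦ does (i <ᶠ? j) ⟧ + ⟦ does (j <ᶠ? i) ⟧) * f i j     ≤⟨ *-monoˡ-≤ (f i j) (at-most-one i j) ⟩
    1 * f i j                                            ≡⟨ *-identityˡ (f i j) ⟩
    f i j                                                ∎

∑ₗ : {A : Set} → List A → (A → ℕ) → ℕ
∑ₗ [] h = 0
∑ₗ (x ∷ xs) h = h x + ∑ₗ xs h

∑ₗ-++ : {A : Set} (xs ys : List A) (h : A → ℕ) → ∑ₗ (xs ++ ys) h ≡ ∑ₗ xs h + ∑ₗ ys h
∑ₗ-++ [] ys h = refl
∑ₗ-++ (x ∷ xs) ys h = trans (cong (h x +_) (∑ₗ-++ xs ys h)) (sym (+-assoc (h x) _ _))

∑ₗ-map : {A B : Set} (f : A → B) (xs : List A) (h : B → ℕ) → ∑ₗ (map f xs) h ≡ ∑ₗ xs (h ∘ f)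
∑ₗ-map f [] h = refl
∑ₗ-map f (x ∷ xs) h = cong (h (f x) +_) (∑ₗ-map f xs h)

∑ₗ-cong : {A : Set} (xs : List A) {f g : A → ℕ} → (∀ x → f x ≡ g x) → ∑ₗ xs f ≡ ∑ₗ xs g
∑ₗ-cong [] f≗g = refl
∑ₗ-cong (x ∷ xs) f≗g = cong₂ _+_ (f≗g x) (∑ₗ-cong xs f≗g)

length-∑ₗ : {A : Set} (xs : List A) → length xs ≡ ∑ₗ xs (λ _ → 1)
length-∑ₗ [] = refl
length-∑ₗ (x ∷ xs) = cong suc (length-∑ₗ xs)

∑ₗ-filter : {A : Set} {P : A → Set} (P? : ∀ x → Dec (P x)) (xs : List A) (h : A → ℕ) →
  ∑ₗ (filter P? xs) h ≡ ∑ₗ xs (λ x → ⟦ does (P? x) ⟧ * h x)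
∑ₗ-filter P? [] h = refl
∑ₗ-filter P? (x ∷ xs) h with does (P? x)
... | true = cong₂ _+_ (sym (+-identityʳ (h x))) (∑ₗ-filter P? xs h)
... | false = ∑ₗ-filter P? xs h

∑ₗ-tabulate : {A : Set} {n : ℕ} (f : Fin n → A) (h : A → ℕ) → ∑ₗ (tabulateₗ f) h ≡ sum (h ∘ f)
∑ₗ-tabulate {n = zero} f h = refl
∑ₗ-tabulate {n = suc n} f h = cong (h (f zero) +_) (∑ₗ-tabulate (f ∘ suc) h)

∑ₗ-allFin : ∀ n (h : Fin n → ℕ) → ∑ₗ (allFin n) h ≡ sum h
∑ₗ-allFin n h = ∑ₗ-tabulate (λ i → i) h

∑ₗ-cartesianProduct : {A B : Set} (xs : List A) (ys : List B) (h : A × B → ℕ) →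
  ∑ₗ (cartesianProduct xs ys) h ≡ ∑ₗ xs (λ x → ∑ₗ ys (λ y → h (x , y)))
∑ₗ-cartesianProduct [] ys h = refl
∑ₗ-cartesianProduct (x ∷ xs) ys h = begin
  ∑ₗ (map (x ,_) ys ++ cartesianProduct xs ys) h
    ≡⟨ ∑ₗ-++ (map (x ,_) ys) (cartesianProduct xs ys) h ⟩
  ∑ₗ (map (x ,_) ys) h + ∑ₗ (cartesianProduct xs ys) h
    ≡⟨ cong₂ _+_ (∑ₗ-map (x ,_) ys h) (∑ₗ-cartesianProduct xs ys h) ⟩
  ∑ₗ ys (λ y → h (x , y)) + ∑ₗ xs (λ x′ → ∑ₗ ys (λ y → h (x′ , y))) ∎
  where open ≡-Reasoning

∑ₗ-lookup : {A : Set} (xs : List A) (h : A → ℕ) → ∑[ i < length xs ] h (lookupₗ xs i) ≡ ∑ₗ xs h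
∑ₗ-lookup [] h = refl
∑ₗ-lookup (x ∷ xs) h = cong (h x +_) (∑ₗ-lookup xs h)

lookup-injective : {A : Set} (xs : List A) → Unique xs →
  ∀ i j → lookupₗ xs i ≡ lookupₗ xs j → i ≡ j
lookup-injective (x ∷ xs) (x∉ ∷ u) zero zero e = refl
lookup-injective (x ∷ xs) (x∉ ∷ u) zero (suc j) e = ⊥-elim (All.lookup x∉ (∈-lookup j) e)
lookup-injective (x ∷ xs) (x∉ ∷ u) (suc i) zero e = ⊥-elim (All.lookup x∉ (∈-lookup i) (sym e))
lookup-injective (x ∷ xs) (x∉ ∷ u) (suc i) (suc j) e = cong suc (lookup-injective xs u i j e)

VertexSet : ℕ → Set
VertexSet m = Fin m → Bool

size : ∀ {m} → VertexSet m → ℕ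
size {m} S = ∑[ v < m ] ⟦ S v ⟧

size-Subset : ∀ {m} (X : Subset m) → ∣ X ∣ ≡ size (lookup X)
size-Subset [] = refl
size-Subset (true ∷ X) = cong suc (size-Subset X)
size-Subset (false ∷ X) = size-Subset X

size-∩ : ∀ {m} (X : Subset m) (f : Fin m → Bool) →
  ∣ X ∩ tabulate f ∣ ≡ ∑[ w < m ] (⟦ lookup X w ⟧ * ⟦ f w ⟧)
size-∩ X f = trans (size-Subset (X ∩ tabulate f)) (sum-cong-≗ λ w → begin
  ⟦ lookup (X ∩ tabulate f) w ⟧  ≡⟨ cong ⟦_⟧ (lookup-zipWith _∧_ w X (tabulate f)) ⟩
  ⟦ lookup X w ∧ lookup (tabulate f) w ⟧ ≡⟨ cong (λ b → ⟦ lookup X w ∧ b ⟧) (lookup∘tabulate f w) ⟩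
  ⟦ lookup X w ∧ f w ⟧           ≡⟨ ⟦∧⟧ (lookup X w) (f w) ⟩
  ⟦ lookup X w ⟧ * ⟦ f w ⟧       ∎)
  where open ≡-Reasoning

elements : ∀ {m} → VertexSet m → List (Fin m)
elements {m} S = filter (T? ∘ S) (allFin m)

elements-unique : ∀ {m} (S : VertexSet m) → Unique (elements S)
elements-unique {m} S = Unique.filter⁺ (T? ∘ S) (Unique.allFin⁺ m)

∑ₗ-elements : ∀ {m} (S : VertexSet m) (g : Fin m → ℕ) →
  ∑ₗ (elements S) g ≡ ∑[ v < m ] (⟦ S v ⟧ * g v)
∑ₗ-elements {m} S g = trans (∑ₗ-filter (T? ∘ S) (allFin m) g) (∑ₗ-allFin m _)

length-elements : ∀ {m} (S : VertexSet m) → length (elements S) ≡ size S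
length-elements S = trans (length-∑ₗ (elements S))
  (trans (∑ₗ-elements S (λ _ → 1)) (sum-cong-≗ λ v → *-identityʳ ⟦ S v ⟧))

delete : ∀ {m} → VertexSet m → Fin m → VertexSet m
delete S u v = S v ∧ not (does (v ≟ u))

sum-delete : ∀ {m} (S : VertexSet m) u → S u ≡ true → (g : Fin m → ℕ) →
  ∑[ v < m ] (⟦ S v ⟧ * g v) ≡ ∑[ v < m ] (⟦ delete S u v ⟧ * g v) + g u
sum-delete {m} S u Su g = begin
  ∑[ v < m ] (⟦ S v ⟧ * g v)
    ≡⟨ sum-cong-≗ (λ v → trans (cong (_* g v) (split v)) (*-distribʳ-+ (g v) ⟦ delete S u v ⟧ _)) ⟩
  ∑[ v < m ] (⟦ delete S u v ⟧ * g v + ⟦ does (v ≟ u) ⟧ * g v)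
    ≡⟨ ∑-distrib-+ (λ v → ⟦ delete S u v ⟧ * g v) (λ v → ⟦ does (v ≟ u) ⟧ * g v) ⟩
  ∑[ v < m ] (⟦ delete S u v ⟧ * g v) + ∑[ v < m ] (⟦ does (v ≟ u) ⟧ * g v)
    ≡⟨ cong (∑[ v < m ] (⟦ delete S u v ⟧ * g v) +_) (sum-point u g) ⟩
  ∑[ v < m ] (⟦ delete S u v ⟧ * g v) + g u ∎
  where
  open ≡-Reasoning
  split : ∀ v → ⟦ S v ⟧ ≡ ⟦ delete S u v ⟧ + ⟦ does (v ≟ u) ⟧
  split v with v ≟ u
  ... | yes refl rewrite Su = refl
  ... | no _ with S v
  ...   | true = refl
  ...   | false = refl

size-delete : ∀ {m} (S : VertexSet m) u → S u ≡ true → size S ≡ size (delete S u) + 1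
size-delete {m} S u Su = begin
  size S                                      ≡⟨ sum-cong-≗ (λ v → sym (*-identityʳ ⟦ S v ⟧)) ⟩
  ∑[ v < m ] (⟦ S v ⟧ * 1)                     ≡⟨ sum-delete S u Su (λ _ → 1) ⟩
  ∑[ v < m ] (⟦ delete S u v ⟧ * 1) + 1        ≡⟨ cong (_+ 1) (sum-cong-≗ (λ v → *-identityʳ ⟦ delete S u v ⟧)) ⟩
  size (delete S u) + 1                       ∎
  where open ≡-Reasoning

argmax : ∀ {m} (S : VertexSet m) (g : Fin m → ℕ) →
  (∀ v → S v ≡ false) ⊎ ∃[ u ] (S u ≡ true × (∀ v → S v ≡ true → g v ≤ g u))
argmax {zero} S g = inj₁ (λ ())
argmax {suc m} S g with argmax (S ∘ suc) (g ∘ suc) | S zero in S₀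
... | inj₁ empty | false = inj₁ λ { zero → S₀ ; (suc v) → empty v }
... | inj₁ empty | true = inj₂ (zero , S₀ , λ
  { zero _ → ≤-refl
  ; (suc v) Sv → contradiction (trans (sym Sv) (empty v)) λ () })
... | inj₂ (u , Su , isMax) | false = inj₂ (suc u , Su , λ
  { zero S₀′ → contradiction (trans (sym S₀′) S₀) λ ()
  ; (suc v) Sv → isMax v Sv })
... | inj₂ (u , Su , isMax) | true with g zero ≤? g (suc u)
...   | yes g₀≤ = inj₂ (suc u , Su , λ { zero _ → g₀≤ ; (suc v) Sv → isMax v Sv })
...   | no g₀≰ = inj₂ (zero , S₀ , λ
  { zero _ → ≤-refl
  ; (suc v) Sv → ≤-trans (isMax v Sv) (<⇒≤ (≰⇒> g₀≰)) })

size-empty : ∀ {m} (S : VertexSet m) → (∀ v → S v ≡ false) → size S ≡ 0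
size-empty {m} S empty = trans (sum-cong-≗ (λ v → cong ⟦_⟧ (empty v))) (trans (sum-const m 0) (*-zeroʳ m))

sum-≤-size*max : ∀ {m} (S : VertexSet m) (g : Fin m → ℕ) u → (∀ v → S v ≡ true → g v ≤ g u) →
  ∑[ v < m ] (⟦ S v ⟧ * g v) ≤ size S * g u
sum-≤-size*max {m} S g u isMax = begin
  ∑[ v < m ] (⟦ S v ⟧ * g v)  ≤⟨ sum-mono termwise ⟩
  ∑[ v < m ] (g u * ⟦ S v ⟧)  ≡⟨ *-distribˡ-sum (g u) (λ v → ⟦ S v ⟧) ⟨
  g u * size S               ≡⟨ *-comm (g u) (size S) ⟩
  size S * g u               ∎
  where
  open ≤-Reasoning
  termwise : ∀ v → ⟦ S v ⟧ * g v ≤ g u * ⟦ S v ⟧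
  termwise v with S v in Sv
  ... | true = ≤-trans (≤-reflexive (+-identityʳ (g v))) (≤-trans (isMax v Sv) (≤-reflexive (sym (*-identityʳ (g u)))))
  ... | false = z≤n

_∈?_ : ∀ {m} (x : Fin m) (xs : List (Fin m)) → Dec (x ∈ xs)
x ∈? xs = DecMembership._∈?_ _≟_ x xs

covered≤length : ∀ {m} (B : List (Fin m)) → ∑[ x < m ] ⟦ does (x ∈? B) ⟧ ≤ length B
covered≤length {m} [] = ≤-reflexive (trans (sum-const m 0) (*-zeroʳ m))
covered≤length {m} (b ∷ B) = begin
  ∑[ x < m ] ⟦ does (x ∈? (b ∷ B)) ⟧                    ≤⟨ sum-mono (λ x → ⟦∨⟧≤ (does (x ≟ b)) (does (x ∈? B))) ⟩
  ∑[ x < m ] (⟦ does (x ≟ b) ⟧ + ⟦ does (x ∈? B) ⟧)     ≡⟨ ∑-distrib-+ (λ x → ⟦ does (x ≟ b) ⟧) _ ⟩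
  ∑[ x < m ] ⟦ does (x ≟ b) ⟧ + ∑[ x < m ] ⟦ does (x ∈? B) ⟧ ≤⟨ +-mono-≤ (≤-reflexive (count-point b)) (covered≤length B) ⟩
  1 + length B                                          ∎
  where
  open ≤-Reasoning
  ⟦∨⟧≤ : ∀ a b → ⟦ a ∨ b ⟧ ≤ ⟦ a ⟧ + ⟦ b ⟧
  ⟦∨⟧≤ true b = s≤s z≤n
  ⟦∨⟧≤ false b = ≤-refl

outside : ∀ {m} (S : VertexSet m) (B : List (Fin m)) → length B < size S → ∃[ x ] (S x ≡ true × x ∉ B)
outside S B ∣B∣<∣S∣ with any? (λ x → (S x ≟ᵇ true) ×-dec ¬? (x ∈? B))
... | yes found = found
... | no none = contradiction (≤-trans (sum-mono covered) (covered≤length B)) (<⇒≱ ∣B∣<∣S∣)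
  where
  covered : ∀ x → ⟦ S x ⟧ ≤ ⟦ does (x ∈? B) ⟧
  covered x with S x in Sx | x ∈? B
  ... | false | _ = z≤n
  ... | true | yes _ = ≤-refl
  ... | true | no x∉B = contradiction (x , Sx , x∉B) none

-- Deleting from a set of size 2 + r a vertex whose non-degree d is at least
-- the average (Y ≤ (2 + r) d, where Y = X + 2d counts the ordered missing
-- pairs before and X after the deletion) does not increase the proportion
-- of missing pairs among all (2 + r)(1 + r) ordered pairs.
density-after-deletion : ∀ r X d Y c D → Y ≡ X + (d + d) → Y ≤ (2 + r) * d →
  Y * c ≤ D * ((2 + r) * (1 + r)) → X * c ≤ D * ((1 + r) * r)
density-after-deletion r X d Y c D refl Y≤ Yc≤ = *-cancelˡ-≤ (2 + r) (begin
  (2 + r) * (X * c)               ≡⟨ *-assoc (2 + r) X c ⟨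
  (2 + r) * X * c                 ≤⟨ *-monoˡ-≤ c scaled ⟩
  r * (X + (d + d)) * c           ≡⟨ *-assoc r _ c ⟩
  r * ((X + (d + d)) * c)         ≤⟨ *-monoʳ-≤ r Yc≤ ⟩
  r * (D * ((2 + r) * (1 + r)))   ≡⟨ reassoc r D ⟩
  (2 + r) * (D * ((1 + r) * r))   ∎)
  where
  open ≤-Reasoning
  reassoc : ∀ r D → r * (D * ((2 + r) * (1 + r))) ≡ (2 + r) * (D * ((1 + r) * r))
  reassoc = solve-∀
  expand : ∀ r X d → (2 + r) * (X + (d + d)) ≡ r * (X + (d + d)) + (X + (d + d) + (X + (d + d)))
  expand = solve-∀
  distrib : ∀ r X d → (2 + r) * X + ((2 + r) * d + (2 + r) * d) ≡ (2 + r) * (X + (d + d))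
  distrib = solve-∀
  scaled : (2 + r) * X ≤ r * (X + (d + d))
  scaled = +-cancelʳ-≤ (X + (d + d) + (X + (d + d))) _ _ (begin
    (2 + r) * X + (X + (d + d) + (X + (d + d)))    ≤⟨ +-monoʳ-≤ ((2 + r) * X) (+-mono-≤ Y≤ Y≤) ⟩
    (2 + r) * X + ((2 + r) * d + (2 + r) * d)      ≡⟨ distrib r X d ⟩
    (2 + r) * (X + (d + d))                        ≡⟨ expand r X d ⟩
    r * (X + (d + d)) + (X + (d + d) + (X + (d + d))) ∎)

-- Let M₀ and M₂ be the numbers of
-- ordered missing pairs of an n-set and of a t-set (2 ≤ t ≤ n) whose
-- proportion of missing pairs is no larger.
few-missing-pairs : ∀ t n Q M₂ M₀ m → 2 ≤ t → t ≤ n → Q + Q ≤ M₂ →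
  M₂ * (n * (n ∸ 1)) ≤ M₀ * (t * (t ∸ 1)) → 2 * (t * t) * M₀ ≤ m * n * n → 4 * Q ≤ m
few-missing-pairs (suc t′) (suc n′) Q M₂ M₀ m (s≤s 1≤t′) (s≤s t′≤n′) 2Q≤ M₂≤ M₀≤ =
  *-cancelʳ-≤ (4 * Q) m K {{K≢0}} (begin
    4 * Q * K                        ≡⟨ e₁ Q (n * n′) (t * t) ⟩
    (Q + Q) * (n * n′) * (2 * (t * t)) ≤⟨ *-monoˡ-≤ (2 * (t * t)) (*-monoˡ-≤ (n * n′) 2Q≤) ⟩
    M₂ * (n * n′) * (2 * (t * t))    ≤⟨ *-monoˡ-≤ (2 * (t * t)) M₂≤ ⟩
    M₀ * (t * t′) * (2 * (t * t))    ≡⟨ e₂ M₀ (t * t′) (t * t) ⟩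
    2 * (t * t) * M₀ * (t * t′)      ≤⟨ *-monoˡ-≤ (t * t′) M₀≤ ⟩
    m * n * n * (t * t′)             ≡⟨ e₃ m n t t′ ⟩
    m * n * t * (n * t′)             ≤⟨ *-monoʳ-≤ (m * n * t) nt′≤tn′ ⟩
    m * n * t * (t * n′)             ≡⟨ e₄ m n t n′ ⟩
    m * K                            ∎)
  where
  open ≤-Reasoning
  t = suc t′
  n = suc n′
  K = (t * t) * (n * n′)
  K≢0 : NonZero K
  K≢0 = m*n≢0 (t * t) (n * n′) {{m*n≢0 t t}} {{m*n≢0 n n′ {{_}} {{>-nonZero (≤-trans 1≤t′ t′≤n′)}}}}
  nt′≤tn′ : n * t′ ≤ t * n′
  nt′≤tn′ = +-mono-≤ t′≤n′ (≤-reflexive (*-comm n′ t′))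
  e₁ : ∀ Q a b → 4 * Q * (b * a) ≡ (Q + Q) * a * (2 * b)
  e₁ = solve-∀
  e₂ : ∀ M a b → M * a * (2 * b) ≡ 2 * b * M * a
  e₂ = solve-∀
  e₃ : ∀ m n t t′ → m * n * n * (t * t′) ≡ m * n * t * (n * t′)
  e₃ = solve-∀
  e₄ : ∀ m n t n′ → m * n * t * (t * n′) ≡ m * ((t * t) * (n * n′))
  e₄ = solve-∀

large-common-part : ∀ m du dw c → 9 * m ≤ 10 * du → 9 * m ≤ 10 * dw →
  du + dw + 2 ≤ m + c → 8 * m + 20 ≤ 10 * c
large-common-part m du dw c du≥ dw≥ du+dw≤ = +-cancelʳ-≤ (10 * m) (8 * m + 20) (10 * c) (begin
  8 * m + 20 + 10 * m         ≡⟨ e₁ m ⟩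
  9 * m + 9 * m + 10 * 2      ≤⟨ +-monoˡ-≤ (10 * 2) (+-mono-≤ du≥ dw≥) ⟩
  10 * du + 10 * dw + 10 * 2  ≡⟨ e₂ du dw ⟩
  10 * (du + dw + 2)          ≤⟨ *-monoʳ-≤ 10 du+dw≤ ⟩
  10 * (m + c)                ≡⟨ e₃ m c ⟩
  10 * c + 10 * m             ∎)
  where
  open ≤-Reasoning
  e₁ : ∀ m → 8 * m + 20 + 10 * m ≡ 9 * m + 9 * m + 10 * 2
  e₁ = solve-∀
  e₂ : ∀ a b → 10 * a + 10 * b + 10 * 2 ≡ 10 * (a + b + 2)
  e₂ = solve-∀
  e₃ : ∀ m c → 10 * (m + c) ≡ 10 * c + 10 * m
  e₃ = solve-∀

-- With at most m/4 pairs to route and t ≤ 11m/20 branch vertices, the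
-- 4m/5 + 2 common neighbours of a pair exceed all vertices already used.
room-for-paths : ∀ Q t n m c → 4 * Q ≤ m → 20 * t ≤ 11 * n → n ≤ m →
  8 * m + 20 ≤ 10 * c → Q + t ≤ c
room-for-paths Q t n m c 4Q≤ 20t≤ n≤m c≥ = *-cancelˡ-≤ 40 (begin
  40 * (Q + t)                 ≡⟨ e₁ Q t ⟩
  10 * (4 * Q) + 2 * (20 * t)  ≤⟨ +-mono-≤ (*-monoʳ-≤ 10 4Q≤) (*-monoʳ-≤ 2 (≤-trans 20t≤ (*-monoʳ-≤ 11 n≤m))) ⟩
  10 * m + 2 * (11 * m)        ≡⟨ e₂ m ⟩
  4 * (8 * m)                  ≤⟨ *-monoʳ-≤ 4 (≤-trans (m≤m+n (8 * m) 20) c≥) ⟩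
  4 * (10 * c)                 ≡⟨ *-assoc 4 10 c ⟨
  40 * c                       ∎)
  where
  open ≤-Reasoning
  e₁ : ∀ Q t → 40 * (Q + t) ≡ 10 * (4 * Q) + 2 * (20 * t)
  e₁ = solve-∀
  e₂ : ∀ m → 10 * m + 2 * (11 * m) ≡ 4 * (8 * m)
  e₂ = solve-∀

-- A vertex of an n-set with d neighbours and d′ = n - 1 - d non-neighbours
-- in it, whose neighbours exceed a (1 - m/D)-fraction of the set, has
-- D d′ ≤ m n.
few-non-neighbours : ∀ D d′ d n mn → d′ + d + 1 ≡ n → D * n < D * d + mn → D * d′ ≤ mn
few-non-neighbours D d′ d n mn n≡ Dn< = <⇒≤ (+-cancelʳ-< (D * d) (D * d′) mn (begin-strict
  D * d′ + D * d  ≡⟨ *-distribˡ-+ D d′ d ⟨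
  D * (d′ + d)    ≤⟨ *-monoʳ-≤ D (≤-trans (m≤m+n (d′ + d) 1) (≤-reflexive n≡)) ⟩
  D * n           <⟨ Dn< ⟩
  D * d + mn      ≡⟨ +-comm (D * d) mn ⟩
  mn + D * d      ∎))
  where open ≤-Reasoning

-- If a vertex of degree d ≥ 9m/10 has at most (1 - m/(2T)) m neighbours,
-- then m ≤ T/5.
order-bound : ∀ T m d → 0 < m → 9 * m ≤ 10 * d → 2 * T * d + m * m ≤ 2 * T * m → 5 * m ≤ T
order-bound T m@(suc _) d _ d≥ d≤ = *-cancelʳ-≤ (5 * m) T (2 * m) (begin
  5 * m * (2 * m)  ≡⟨ e₁ m ⟩
  10 * (m * m)     ≤⟨ +-cancelˡ-≤ (9 * (E * m)) (10 * (m * m)) (E * m) scaled ⟩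
  E * m            ≡⟨ e₂ T m ⟩
  T * (2 * m)      ∎)
  where
  open ≤-Reasoning
  E = 2 * T
  e₁ : ∀ m → 5 * m * (2 * m) ≡ 10 * (m * m)
  e₁ = solve-∀
  e₂ : ∀ T m → 2 * T * m ≡ T * (2 * m)
  e₂ = solve-∀
  e₃ : ∀ E m → E * (9 * m) ≡ 9 * (E * m)
  e₃ = solve-∀
  e₄ : ∀ E d m → 10 * (E * d + m * m) ≡ E * (10 * d) + 10 * (m * m)
  e₄ = solve-∀
  e₅ : ∀ E m → 10 * (E * m) ≡ 9 * (E * m) + E * m
  e₅ = solve-∀
  scaled : 9 * (E * m) + 10 * (m * m) ≤ 9 * (E * m) + E * m
  scaled = begin
    9 * (E * m) + 10 * (m * m)    ≡⟨ cong (_+ 10 * (m * m)) (e₃ E m) ⟨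
    E * (9 * m) + 10 * (m * m)    ≤⟨ +-monoˡ-≤ (10 * (m * m)) (*-monoʳ-≤ E d≥) ⟩
    E * (10 * d) + 10 * (m * m)   ≡⟨ e₄ E d m ⟨
    10 * (E * d + m * m)          ≤⟨ *-monoʳ-≤ 10 d≤ ⟩
    10 * (E * m)                  ≡⟨ e₅ E m ⟩
    9 * (E * m) + E * m           ∎

toℚᵘ-/ : ∀ (i : ℤ.ℤ) k → ℚ.toℚᵘ (i ℚ./ suc k) ℚᵘ.≃ ℚᵘ.mkℚᵘ i k
toℚᵘ-/ i k = ℚ.toℚᵘ-fromℚᵘ (ℚᵘ.mkℚᵘ i k)

/-≤⇒ : ∀ a b k l → (ℤ.+ a ℚ./ suc k) ≤ℚ (ℤ.+ b ℚ./ suc l) → a * suc l ≤ b * suc k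
/-≤⇒ a b k l a/k≤b/l
  with ℚᵘ.≤-respʳ-≃ (toℚᵘ-/ (ℤ.+ b) l) (ℚᵘ.≤-respˡ-≃ (toℚᵘ-/ (ℤ.+ a) k) (ℚ.toℚᵘ-mono-≤ a/k≤b/l))
... | ℚᵘ.*≤* al≤bk = ℤ.drop‿+≤+ (subst₂ ℤ._≤_ (sym (ℤ.pos-* a (suc l))) (sym (ℤ.pos-* b (suc k))) al≤bk)

/-≤⇐ : ∀ a b k l → a * suc l ≤ b * suc k → (ℤ.+ a ℚ./ suc k) ≤ℚ (ℤ.+ b ℚ./ suc l)
/-≤⇐ a b k l al≤bk = ℚ.toℚᵘ-cancel-≤
  (ℚᵘ.≤-respʳ-≃ (ℚᵘ.≃-sym (toℚᵘ-/ (ℤ.+ b) l)) (ℚᵘ.≤-respˡ-≃ (ℚᵘ.≃-sym (toℚᵘ-/ (ℤ.+ a) k))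
    (ℚᵘ.*≤* (subst₂ ℤ._≤_ (ℤ.pos-* a (suc l)) (ℤ.pos-* b (suc k)) (ℤ.+≤+ al≤bk)))))

over-≤⇒ : ∀ a b k → (a over suc k) ≤ℚ (b over 1) → a ≤ suc k * b
over-≤⇒ a b k a/k≤b = subst₂ _≤_ (*-identityʳ a) (*-comm b (suc k)) (/-≤⇒ a b k 0 a/k≤b)

over-≤⇐ : ∀ a b k → suc k * a ≤ b → (a over 1) ≤ℚ (b over suc k)
over-≤⇐ a b k ka≤b = /-≤⇐ a b 0 k (subst₂ _≤_ (*-comm (suc k) a) (sym (*-identityʳ b)) ka≤b)

≤-one-minus-fraction : ∀ d n M D′ → suc D′ * d + M * n ≤ suc D′ * n →
  (ℤ.+ d ℚ./ 1) ≤ℚ ((1ℚ - (ℤ.+ M ℚ./ suc D′)) ℚ.* (ℤ.+ n ℚ./ 1))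
≤-one-minus-fraction d n M D′ Dd+Mn≤Dn = ℚ.toℚᵘ-cancel-≤
  (ℚᵘ.≤-respʳ-≃ (ℚᵘ.≃-sym rhs≃) (ℚᵘ.≤-respˡ-≃ (ℚᵘ.≃-sym (toℚᵘ-/ (ℤ.+ d) 0)) (ℚᵘ.*≤* (subst₂ ℤ._≤_ lhs≡ rhs≡ core))))
  where
  D = suc D′
  q = ℤ.+ M ℚ./ D
  rhs≃ : ℚ.toℚᵘ ((1ℚ - q) ℚ.* (ℤ.+ n ℚ./ 1)) ℚᵘ.≃ ((ℚᵘ.1ℚᵘ ℚᵘ.- ℚᵘ.mkℚᵘ (ℤ.+ M) D′) ℚᵘ.* ℚᵘ.mkℚᵘ (ℤ.+ n) 0)
  rhs≃ = ℚᵘ.≃-trans (ℚ.toℚᵘ-homo-* (1ℚ - q) (ℤ.+ n ℚ./ 1))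
    (ℚᵘ.*-cong (ℚᵘ.≃-trans (ℚ.toℚᵘ-homo-+ 1ℚ (ℚ.- q))
                 (ℚᵘ.+-cong (toℚᵘ-/ (ℤ.+ 1) 0) (ℚᵘ.≃-trans (ℚ.toℚᵘ-homo‿- q) (ℚᵘ.-‿cong (toℚᵘ-/ (ℤ.+ M) D′)))))
               (toℚᵘ-/ (ℤ.+ n) 0))
  cross : ∀ (D M n : ℤ.ℤ) → ((ℤ.+ 1 ℤ.* D ℤ.+ ℤ.- M ℤ.* ℤ.+ 1) ℤ.* n) ℤ.* ℤ.+ 1 ≡ D ℤ.* n ℤ.- M ℤ.* n
  cross = solveℤ-∀
  cancel : ∀ (i j : ℤ.ℤ) → i ℤ.+ j ℤ.- j ≡ i
  cancel = solveℤ-∀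
  lhs≡ : ℤ.+ (D * d) ≡ ℤ.+ d ℤ.* ℤ.+ (1 * D * 1)
  lhs≡ = trans (cong ℤ.+_ (trans (*-comm D d) (cong (d *_) (sym (trans (*-identityʳ (1 * D)) (*-identityˡ D))))))
               (ℤ.pos-* d (1 * D * 1))
  rhs≡ : ℤ.+ (D * n) ℤ.- ℤ.+ (M * n) ≡ ((ℤ.+ 1 ℤ.* ℤ.+ D ℤ.+ ℤ.- (ℤ.+ M) ℤ.* ℤ.+ 1) ℤ.* ℤ.+ n) ℤ.* ℤ.+ 1
  rhs≡ = sym (trans (cross (ℤ.+ D) (ℤ.+ M) (ℤ.+ n)) (cong₂ ℤ._-_ (sym (ℤ.pos-* D n)) (sym (ℤ.pos-* M n))))
  core : ℤ.+ (D * d) ℤ.≤ ℤ.+ (D * n) ℤ.- ℤ.+ (M * n)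
  core = subst (ℤ._≤ ℤ.+ (D * n) ℤ.- ℤ.+ (M * n)) (cancel (ℤ.+ (D * d)) (ℤ.+ (M * n)))
    (ℤ.+-monoˡ-≤ (ℤ.- ℤ.+ (M * n)) (subst (ℤ._≤ ℤ.+ (D * n)) (ℤ.pos-+ (D * d) (M * n)) (ℤ.+≤+ Dd+Mn≤Dn)))

module _ {m : ℕ} (G : Graph m) where
  open Graph G hiding (sym)

  adjᵇ : Fin m → Fin m → Bool
  adjᵇ u w = does (adj? u w)

  NonAdjacent : Fin m → Fin m → Set
  NonAdjacent u w = ¬ u ≡ w × ¬ Adj u w

  nonAdjacent? : ∀ u w → Dec (NonAdjacent u w)
  nonAdjacent? u w = ¬? (u ≟ w) ×-dec ¬? (adj? u w)

  ν : Fin m → Fin m → ℕ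
  ν u w = ⟦ does (nonAdjacent? u w) ⟧

  ν-self : ∀ u → ν u u ≡ 0
  ν-self u with u ≟ u
  ... | yes _ = refl
  ... | no u≢u = contradiction refl u≢u

  ν-sym : ∀ u w → ν u w ≡ ν w u
  ν-sym u w with u ≟ w | w ≟ u
  ... | yes _ | yes _ = refl
  ... | yes u≡w | no w≢u = contradiction (sym u≡w) w≢u
  ... | no u≢w | yes w≡u = contradiction (sym w≡u) u≢w
  ... | no _ | no _ with adj? u w | adj? w u
  ...   | yes _ | yes _ = refl
  ...   | yes uw | no ¬wu = contradiction (Graph.sym G uw) ¬wu
  ...   | no ¬uw | yes wu = contradiction (Graph.sym G wu) ¬uw
  ...   | no _ | no _ = refl

  trichotomy : ∀ u w → ν u w + ⟦ adjᵇ u w ⟧ + ⟦ does (w ≟ u) ⟧ ≡ 1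
  trichotomy u w with w ≟ u
  ... | yes refl with u ≟ u | adj? u u
  ...   | yes _ | no _ = refl
  ...   | yes _ | yes uu = contradiction uu irrefl
  ...   | no u≢u | _ = contradiction refl u≢u
  trichotomy u w | no w≢u with u ≟ w
  ...   | yes u≡w = contradiction (sym u≡w) w≢u
  ...   | no _ with adj? u w
  ...     | yes _ = refl
  ...     | no _ = refl

  degree-sum : ∀ u → degree u ≡ ∑[ w < m ] ⟦ adjᵇ u w ⟧
  degree-sum u = trans (size-Subset (N u)) (sum-cong-≗ λ w → cong ⟦_⟧ (lookup∘tabulate (adjᵇ u) w))

  degreeIn-sum : ∀ X u → degreeIn X u ≡ ∑[ w < m ] (⟦ lookup X w ⟧ * ⟦ adjᵇ u w ⟧)
  degreeIn-sum X u = size-∩ X (adjᵇ u)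

  nonDegree : VertexSet m → Fin m → ℕ
  nonDegree S u = ∑[ w < m ] (⟦ S w ⟧ * ν u w)

  -- The number of ordered pairs of distinct non-adjacent vertices of S,
  -- i.e. twice the number of non-edges of G[S].
  missing : VertexSet m → ℕ
  missing S = ∑[ u < m ] (⟦ S u ⟧ * nonDegree S u)

  nonDegree-degreeIn : ∀ X u → lookup X u ≡ true → nonDegree (lookup X) u + degreeIn X u + 1 ≡ ∣ X ∣
  nonDegree-degreeIn X u Xu = begin
    nonDegree S u + degreeIn X u + 1
      ≡⟨ cong₂ (λ a b → nonDegree S u + a + b) (degreeIn-sum X u) (sym (trans (sum-point u (⟦_⟧ ∘ S)) (cong ⟦_⟧ Xu))) ⟩
    ∑[ w < m ] (⟦ S w ⟧ * ν u w) + ∑[ w < m ] (⟦ S w ⟧ * ⟦ adjᵇ u w ⟧) + ∑[ w < m ] (⟦ does (w ≟ u) ⟧ * ⟦ S w ⟧)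
      ≡⟨ cong (_+ ∑[ w < m ] (⟦ does (w ≟ u) ⟧ * ⟦ S w ⟧)) (∑-distrib-+ (λ w → ⟦ S w ⟧ * ν u w) _) ⟨
    ∑[ w < m ] (⟦ S w ⟧ * ν u w + ⟦ S w ⟧ * ⟦ adjᵇ u w ⟧) + ∑[ w < m ] (⟦ does (w ≟ u) ⟧ * ⟦ S w ⟧)
      ≡⟨ ∑-distrib-+ (λ w → ⟦ S w ⟧ * ν u w + ⟦ S w ⟧ * ⟦ adjᵇ u w ⟧) _ ⟨
    ∑[ w < m ] (⟦ S w ⟧ * ν u w + ⟦ S w ⟧ * ⟦ adjᵇ u w ⟧ + ⟦ does (w ≟ u) ⟧ * ⟦ S w ⟧)
      ≡⟨ sum-cong-≗ termwise ⟩
    size S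
      ≡⟨ size-Subset X ⟨
    ∣ X ∣ ∎
    where
    open ≡-Reasoning
    S = lookup X
    distrib : ∀ s a b c → s * a + s * b + c * s ≡ s * (a + b + c)
    distrib = solve-∀
    termwise : ∀ w → ⟦ S w ⟧ * ν u w + ⟦ S w ⟧ * ⟦ adjᵇ u w ⟧ + ⟦ does (w ≟ u) ⟧ * ⟦ S w ⟧ ≡ ⟦ S w ⟧
    termwise w = trans (distrib ⟦ S w ⟧ (ν u w) _ _)
      (trans (cong (⟦ S w ⟧ *_) (trichotomy u w)) (*-identityʳ ⟦ S w ⟧))

  missing-delete : ∀ S u → S u ≡ true → missing S ≡ missing (delete S u) + (nonDegree S u + nonDegree S u)
  missing-delete S u Su = begin
    missing S
      ≡⟨ sum-delete S u Su (nonDegree S) ⟩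
    ∑[ v < m ] (⟦ S′ v ⟧ * nonDegree S v) + nonDegree S u
      ≡⟨ cong (_+ nonDegree S u) (sum-cong-≗ λ v →
           trans (cong (⟦ S′ v ⟧ *_) (sum-delete S u Su (ν v))) (*-distribˡ-+ ⟦ S′ v ⟧ (nonDegree S′ v) (ν v u))) ⟩
    ∑[ v < m ] (⟦ S′ v ⟧ * nonDegree S′ v + ⟦ S′ v ⟧ * ν v u) + nonDegree S u
      ≡⟨ cong (_+ nonDegree S u) (∑-distrib-+ (λ v → ⟦ S′ v ⟧ * nonDegree S′ v) (λ v → ⟦ S′ v ⟧ * ν v u)) ⟩
    missing S′ + ∑[ v < m ] (⟦ S′ v ⟧ * ν v u) + nonDegree S u
      ≡⟨ cong (λ x → missing S′ + x + nonDegree S u) throughU ⟩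
    missing S′ + nonDegree S u + nonDegree S u
      ≡⟨ +-assoc (missing S′) (nonDegree S u) (nonDegree S u) ⟩
    missing S′ + (nonDegree S u + nonDegree S u) ∎
    where
    open ≡-Reasoning
    S′ = delete S u
    throughU : ∑[ v < m ] (⟦ S′ v ⟧ * ν v u) ≡ nonDegree S u
    throughU = begin
      ∑[ v < m ] (⟦ S′ v ⟧ * ν v u)   ≡⟨ sum-cong-≗ (λ v → cong (⟦ S′ v ⟧ *_) (ν-sym v u)) ⟩
      nonDegree S′ u                  ≡⟨ +-identityʳ _ ⟨
      nonDegree S′ u + 0              ≡⟨ cong (nonDegree S′ u +_) (ν-self u) ⟨
      nonDegree S′ u + ν u u          ≡⟨ sum-delete S u Su (ν u) ⟨
      nonDegree S u                   ∎

  missing-elements : ∀ S → ∑ₗ (elements S) (λ u → ∑ₗ (elements S) (ν u)) ≡ missing S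
  missing-elements S = trans (∑ₗ-cong (elements S) (λ u → ∑ₗ-elements S (ν u))) (∑ₗ-elements S (nonDegree S))

  -- Deleting vertices of maximum non-degree one at a time, a set of t + k
  -- vertices (t ≥ 1) shrinks to a t-set whose proportion of missing pairs,
  -- missing S / (|S| (|S| - 1)), has not increased (here bounded by D₀ / c).
  sparse-subset : ∀ t′ k c D₀ (S : VertexSet m) → size S ≡ suc t′ + k →
    missing S * c ≤ D₀ * (size S * (size S ∸ 1)) →
    ∃[ S′ ] (size S′ ≡ suc t′ × missing S′ * c ≤ D₀ * (suc t′ * t′))
  sparse-subset t′ zero c D₀ S ∣S∣≡ dense =
    S , ∣S∣≡t , subst (λ s → missing S * c ≤ D₀ * (s * (s ∸ 1))) ∣S∣≡t dense
    where ∣S∣≡t = trans ∣S∣≡ (+-identityʳ (suc t′))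
  sparse-subset t′ (suc k) c D₀ S ∣S∣≡ dense with argmax S (nonDegree S)
  ... | inj₁ empty = contradiction (trans (sym (size-empty S empty)) ∣S∣≡2+r) 0≢1+n
    where ∣S∣≡2+r = trans ∣S∣≡ (+-suc (suc t′) k)
  ... | inj₂ (u , Su , isMax) = sparse-subset t′ k c D₀ (delete S u) ∣S′∣≡ dense′
    where
    r = t′ + k
    ∣S∣≡2+r : size S ≡ 2 + r
    ∣S∣≡2+r = trans ∣S∣≡ (+-suc (suc t′) k)
    ∣S′∣≡ : size (delete S u) ≡ 1 + r
    ∣S′∣≡ = suc-injective (trans (+-comm 1 _) (trans (sym (size-delete S u Su)) ∣S∣≡2+r))
    below-max : missing S ≤ (2 + r) * nonDegree S u
    below-max = subst (λ s → missing S ≤ s * nonDegree S u) ∣S∣≡2+r (sum-≤-size*max S (nonDegree S) u isMax)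
    dense′ : missing (delete S u) * c ≤ D₀ * (size (delete S u) * (size (delete S u) ∸ 1))
    dense′ = subst (λ s → missing (delete S u) * c ≤ D₀ * (s * (s ∸ 1))) (sym ∣S′∣≡)
      (density-after-deletion r (missing (delete S u)) (nonDegree S u) (missing S) c D₀ (missing-delete S u Su) below-max
        (subst (λ s → missing S * c ≤ D₀ * (s * (s ∸ 1))) ∣S∣≡2+r dense))

  common : Fin m → Fin m → ℕ
  common u w = ∑[ x < m ] (⟦ adjᵇ u x ⟧ * ⟦ adjᵇ w x ⟧)

  -- Inclusion–exclusion for the sets N(u), N(w), {u}, {w} of a non-adjacent
  -- pair: only N(u) and N(w) can overlap.
  degrees≤ : ∀ u w → NonAdjacent u w → degree u + degree w + 2 ≤ m + common u w
  degrees≤ u w (u≢w , ¬uw) = begin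
    degree u + degree w + 2
      ≡⟨ cong₂ (λ a b → a + b + 2) (degree-sum u) (degree-sum w) ⟩
    sum A + sum B + 2
      ≡⟨ cong (sum A + sum B +_) (cong₂ _+_ (count-point u) (count-point w)) ⟨
    sum A + sum B + (sum Iu + sum Iw)
      ≡⟨ +-assoc (sum A + sum B) (sum Iu) (sum Iw) ⟨
    sum A + sum B + sum Iu + sum Iw
      ≡⟨ distribute ⟨
    ∑[ x < m ] (A x + B x + Iu x + Iw x)
      ≤⟨ sum-mono termwise ⟩
    ∑[ x < m ] (1 + A x * B x)
      ≡⟨ ∑-distrib-+ (λ _ → 1) (λ x → A x * B x) ⟩
    ∑[ x < m ] 1 + common u w
      ≡⟨ cong (_+ common u w) (trans (sum-const m 1) (*-identityʳ m)) ⟩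
    m + common u w ∎
    where
    open ≤-Reasoning
    A B Iu Iw : Fin m → ℕ
    A x = ⟦ adjᵇ u x ⟧
    B x = ⟦ adjᵇ w x ⟧
    Iu x = ⟦ does (x ≟ u) ⟧
    Iw x = ⟦ does (x ≟ w) ⟧
    distribute : ∑[ x < m ] (A x + B x + Iu x + Iw x) ≡ sum A + sum B + sum Iu + sum Iw
    distribute = trans (∑-distrib-+ (λ x → A x + B x + Iu x) Iw)
      (cong (_+ sum Iw) (trans (∑-distrib-+ (λ x → A x + B x) Iu) (cong (_+ sum Iu) (∑-distrib-+ A B))))
    termwise : ∀ x → A x + B x + Iu x + Iw x ≤ 1 + A x * B x
    termwise x with adj? u x | adj? w x | x ≟ u | x ≟ w
    ... | yes ux | _ | yes refl | _ = contradiction ux irrefl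
    ... | _ | yes wx | _ | yes refl = contradiction wx irrefl
    ... | _ | yes wx | yes refl | _ = contradiction (Graph.sym G wx) ¬uw
    ... | yes ux | _ | _ | yes refl = contradiction ux ¬uw
    ... | _ | _ | yes refl | yes refl = contradiction refl u≢w
    ... | yes _ | yes _ | no _ | no _ = ≤-refl
    ... | yes _ | no _ | no _ | no _ = ≤-refl
    ... | no _ | yes _ | no _ | no _ = ≤-refl
    ... | no _ | no _ | yes _ | no _ = ≤-refl
    ... | no _ | no _ | no _ | yes _ = ≤-refl
    ... | no _ | no _ | no _ | no _ = z≤n

  common-large : (∀ v → 9 * m ≤ 10 * degree v) → ∀ u w → NonAdjacent u w → 8 * m + 20 ≤ 10 * common u w
  common-large minDeg u w uw = large-common-part m (degree u) (degree w) (common u w) (minDeg u) (minDeg w) (degrees≤ u w uw)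

-- Adjacent branch vertices are joined by an edge; every other pair gets a
-- path of length two through a middle vertex: a common neighbour outside L
-- used by no other pair.  Middle vertices are chosen greedily, which
-- succeeds when every such pair has more common neighbours than |L| plus
-- the number of pairs to be routed.
module Routing {m : ℕ} (G : Graph m) (L : List (Fin m)) (L-unique : Unique L) where
  open Graph G using (Adj; adj?)

  n : ℕ
  n = length L

  branch : Fin n → Fin m
  branch = lookupₗ L

  Pair : Set
  Pair = Fin n × Fin n

  _≟ₚ_ : (p q : Pair) → Dec (p ≡ q)
  _≟ₚ_ = ≡-dec _≟_ _≟_

  NeedsMiddle : Pair → Set
  NeedsMiddle (i , j) = i <ᶠ j × NonAdjacent G (branch i) (branch j)

  needsMiddle? : ∀ p → Dec (NeedsMiddle p)
  needsMiddle? (i , j) = (i <ᶠ? j) ×-dec nonAdjacent? G (branch i) (branch j)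

  toRoute : List Pair
  toRoute = filter needsMiddle? (cartesianProduct (allFin n) (allFin n))

  toRoute-complete : ∀ i j → NeedsMiddle (i , j) → (i , j) ∈ toRoute
  toRoute-complete i j = ∈-filter⁺ needsMiddle? (∈-cartesianProduct⁺ (∈-allFin i) (∈-allFin j))

  toRoute-sound : ∀ {q} → q ∈ toRoute → NeedsMiddle q
  toRoute-sound q∈ = proj₂ (∈-filter⁻ needsMiddle? {xs = cartesianProduct (allFin n) (allFin n)} q∈)

  toRoute-length : length toRoute ≡ ∑[ i < n ] ∑[ j < n ] (⟦ does (i <ᶠ? j) ⟧ * ν G (branch i) (branch j))
  toRoute-length = begin
    length toRoute
      ≡⟨ length-∑ₗ toRoute ⟩
    ∑ₗ toRoute (λ _ → 1)
      ≡⟨ ∑ₗ-filter needsMiddle? (cartesianProduct (allFin n) (allFin n)) (λ _ → 1) ⟩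
    ∑ₗ (cartesianProduct (allFin n) (allFin n)) indicator
      ≡⟨ ∑ₗ-cartesianProduct (allFin n) (allFin n) indicator ⟩
    ∑ₗ (allFin n) (λ i → ∑ₗ (allFin n) (λ j → indicator (i , j)))
      ≡⟨ trans (∑ₗ-cong (allFin n) (λ i → ∑ₗ-allFin n (λ j → indicator (i , j))))
                 (∑ₗ-allFin n (λ i → ∑[ j < n ] indicator (i , j))) ⟩
    ∑[ i < n ] ∑[ j < n ] indicator (i , j)
      ≡⟨ sum-cong-≗ (λ i → sum-cong-≗ λ j → trans (*-identityʳ (⟦ does (needsMiddle? (i , j)) ⟧))
                                                  (⟦∧⟧ (does (i <ᶠ? j)) (does (nonAdjacent? G (branch i) (branch j))))) ⟩
    ∑[ i < n ] ∑[ j < n ] (⟦ does (i <ᶠ? j) ⟧ * ν G (branch i) (branch j)) ∎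
    where
    open ≡-Reasoning
    indicator : Pair → ℕ
    indicator p = ⟦ does (needsMiddle? p) ⟧ * 1

  toRoute-count : length toRoute + length toRoute ≤ ∑ₗ L (λ u → ∑ₗ L (ν G u))
  toRoute-count = begin
    length toRoute + length toRoute
      ≡⟨ cong₂ _+_ toRoute-length toRoute-length ⟩
    _ ≤⟨ sum-below-diagonal (λ i j → ν G (branch i) (branch j)) (λ i j → ν-sym G (branch i) (branch j)) ⟩
    ∑[ i < n ] ∑[ j < n ] ν G (branch i) (branch j)
      ≡⟨ trans (sum-cong-≗ λ i → ∑ₗ-lookup L (ν G (branch i))) (∑ₗ-lookup L (λ u → ∑ₗ L (ν G u))) ⟩
    ∑ₗ L (λ u → ∑ₗ L (ν G u)) ∎
    where open ≤-Reasoning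

  commonOf : Pair → ℕ
  commonOf (i , j) = common G (branch i) (branch j)

  CommonNeighbour : Pair → Fin m → Set
  CommonNeighbour (i , j) x = Adj (branch i) x × Adj (branch j) x

  record Middles (Q : List Pair) (U : List (Fin m)) (mid : Pair → Fin m) : Set where
    field
      adjacent : ∀ {q} → q ∈ Q → CommonNeighbour q (mid q)
      unused   : ∀ {q} → q ∈ Q → mid q ∉ U
      external : ∀ {q} → q ∈ Q → mid q ∉ L
      distinct : ∀ {p q} → p ∈ Q → q ∈ Q → mid p ≡ mid q → p ≡ q

  fresh-middle : ∀ q U → length (U ++ L) < commonOf q → ∃[ x ] (CommonNeighbour q x × x ∉ U × x ∉ L)
  fresh-middle (i , j) U ∣UL∣<
    with outside (λ x → adjᵇ G (branch i) x ∧ adjᵇ G (branch j) x) (U ++ L)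
                 (≤-trans ∣UL∣< (≤-reflexive (sum-cong-≗ λ x → sym (⟦∧⟧ (adjᵇ G (branch i) x) (adjᵇ G (branch j) x)))))
  ... | x , x∈N , x∉UL = x , both (branch i) (branch j) x x∈N , x∉UL ∘ ∈-++⁺ˡ , x∉UL ∘ ∈-++⁺ʳ U
    where
    both : ∀ a b x → does (adj? a x) ∧ does (adj? b x) ≡ true → Adj a x × Adj b x
    both a b x ab with adj? a x | adj? b x
    ... | yes ax | yes bx = ax , bx
    ... | yes _ | no _ = contradiction ab λ ()
    ... | no _ | _ = contradiction ab λ ()

  -- Greedy choice of middle vertices, one pair at a time; U collects the
  -- middle vertices chosen so far.
  middles : ∀ Q U → (∀ {q} → q ∈ Q → length U + length Q + n ≤ commonOf q) → ∃[ mid ] Middles Q U mid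
  middles [] U _ = branch ∘ proj₁ , record { adjacent = λ () ; unused = λ () ; external = λ () ; distinct = λ () }
  middles (q ∷ Q) U enough = mid , record
    { adjacent = adjacent ; unused = unused ; external = external ; distinct = distinct }
    where
    room : length (U ++ L) < commonOf q
    room = begin-strict
      length (U ++ L)                    ≡⟨ length-++ U ⟩
      length U + n                       <⟨ +-monoˡ-< n (m<m+n (length U) (s≤s z≤n)) ⟩
      length U + length (q ∷ Q) + n      ≤⟨ enough (here refl) ⟩
      commonOf q                         ∎
      where open ≤-Reasoning
    fresh = fresh-middle q U room
    x = proj₁ fresh
    rest = middles Q (x ∷ U) λ {p} p∈ →
      subst (λ k → k + n ≤ commonOf p) (+-suc (length U) (length Q)) (enough (there p∈))
    module Rest = Middles (proj₂ rest)
    mid : Pair → Fin m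
    mid p with p ≟ₚ q
    ... | yes _ = x
    ... | no _ = proj₁ rest p
    adjacent : ∀ {p} → p ∈ q ∷ Q → CommonNeighbour p (mid p)
    adjacent {p} p∈ with p ≟ₚ q
    ... | yes refl = proj₁ (proj₂ fresh)
    ... | no p≢q = Rest.adjacent (Any.tail p≢q p∈)
    unused : ∀ {p} → p ∈ q ∷ Q → mid p ∉ U
    unused {p} p∈ with p ≟ₚ q
    ... | yes refl = proj₁ (proj₂ (proj₂ fresh))
    ... | no p≢q = Rest.unused (Any.tail p≢q p∈) ∘ there
    external : ∀ {p} → p ∈ q ∷ Q → mid p ∉ L
    external {p} p∈ with p ≟ₚ q
    ... | yes refl = proj₂ (proj₂ (proj₂ fresh))
    ... | no p≢q = Rest.external (Any.tail p≢q p∈)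
    distinct : ∀ {p p′} → p ∈ q ∷ Q → p′ ∈ q ∷ Q → mid p ≡ mid p′ → p ≡ p′
    distinct {p} {p′} p∈ p′∈ same with p ≟ₚ q | p′ ≟ₚ q
    ... | yes p≡q | yes p′≡q = trans p≡q (sym p′≡q)
    ... | yes _ | no p′≢q = contradiction (here (sym same)) (Rest.unused (Any.tail p′≢q p′∈))
    ... | no p≢q | yes _ = contradiction (here same) (Rest.unused (Any.tail p≢q p∈))
    ... | no p≢q | no p′≢q = Rest.distinct (Any.tail p≢q p∈) (Any.tail p′≢q p′∈) same

  subdivision : (∀ {q} → q ∈ toRoute → length toRoute + n ≤ commonOf q) → Subdivision G n
  subdivision enough = record
    { branch = branch
    ; branch-inj = λ {i} {j} → lookup-injective L L-unique i j
    ; path = λ i j _ → path i j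
    ; path-walk = walk
    ; path-uniq = unique
    ; internal-not-branch = not-branch
    ; disjoint = disjoint
    }
    where
    chosen = middles toRoute [] enough
    mid = proj₁ chosen
    module M = Middles (proj₂ chosen)
    routed : ∀ i j → i <ᶠ j → ¬ Adj (branch i) (branch j) → (i , j) ∈ toRoute
    routed i j i<j ¬adj = toRoute-complete i j
      (i<j , (λ same → <ᶠ⇒≢ i<j (lookup-injective L L-unique i j same)) , ¬adj)
    path : Fin n → Fin n → List (Fin m)
    path i j with adj? (branch i) (branch j)
    ... | yes _ = []
    ... | no _ = mid (i , j) ∷ []
    walk : ∀ i j → i <ᶠ j → Graph.Walk G (branch i) (path i j) (branch j)
    walk i j i<j with adj? (branch i) (branch j)
    ... | yes adj = adj
    ... | no ¬adj = let (to-i , to-j) = M.adjacent (routed i j i<j ¬adj) in to-i , Graph.sym G to-j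
    unique : ∀ i j → i <ᶠ j → Unique (path i j)
    unique i j _ with adj? (branch i) (branch j)
    ... | yes _ = []
    ... | no _ = [] ∷ []
    not-branch : ∀ i j → i <ᶠ j → ∀ k → branch k ∉ path i j
    not-branch i j i<j k with adj? (branch i) (branch j)
    ... | yes _ = λ ()
    ... | no ¬adj = λ { (here k≡mid) → M.external (routed i j i<j ¬adj) (subst (_∈ L) k≡mid (∈-lookup k)) }
    disjoint : ∀ i j → i <ᶠ j → ∀ k l → k <ᶠ l → ∀ v → v ∈ path i j → v ∈ path k l → i ≡ k × j ≡ l
    disjoint i j i<j k l k<l v with adj? (branch i) (branch j) | adj? (branch k) (branch l)
    ... | yes _ | _ = λ ()
    ... | no _ | yes _ = λ _ ()
    ... | no ¬ij | no ¬kl = λ { (here v≡ij) (here v≡kl) →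
      let same = M.distinct (routed i j i<j ¬ij) (routed k l k<l ¬kl) (trans (sym v≡ij) v≡kl)
      in cong proj₁ same , cong proj₂ same }

single-vertex : ∀ {m} (G : Graph m) → Fin m → Subdivision G 1
single-vertex G v = record
  { branch = λ _ → v
  ; branch-inj = λ { {zero} {zero} _ → refl }
  ; path = λ _ _ _ → []
  ; path-walk = λ { zero zero () }
  ; path-uniq = λ { zero zero () }
  ; internal-not-branch = λ { zero zero () }
  ; disjoint = λ { zero zero () }
  }

some-vertex : ∀ {m} → 0 < m → Fin m
some-vertex {suc _} _ = zero

module _ {m : ℕ} (G : Graph m) where
  open Graph G using (degree; degreeIn)

  MinDegree : Set
  MinDegree = ∀ v → 9 * m ≤ 10 * degree v

  Dense : ℕ → Subset m → Set
  Dense t X = ∀ v → lookup X v ≡ true → 2 * (t * t) * ∣ X ∣ < 2 * (t * t) * degreeIn X v + m * ∣ X ∣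

  -- In a dense set every vertex misses at most m|X|/(2t²) others, so
  -- 2t² · missing(X) ≤ m |X|².
  dense⇒few-missing : ∀ t X → Dense t X → 2 * (t * t) * missing G (lookup X) ≤ m * ∣ X ∣ * ∣ X ∣
  dense⇒few-missing t X dense = begin
    D * missing G S                                   ≡⟨ *-distribˡ-sum D (λ u → ⟦ S u ⟧ * nonDegree G S u) ⟩
    ∑[ u < m ] (D * (⟦ S u ⟧ * nonDegree G S u))       ≤⟨ sum-mono termwise ⟩
    ∑[ u < m ] (m * ∣ X ∣ * ⟦ S u ⟧)                    ≡⟨ *-distribˡ-sum (m * ∣ X ∣) (⟦_⟧ ∘ S) ⟨
    m * ∣ X ∣ * size S                                  ≡⟨ cong (m * ∣ X ∣ *_) (size-Subset X) ⟨
    m * ∣ X ∣ * ∣ X ∣                                   ∎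
    where
    open ≤-Reasoning
    D = 2 * (t * t)
    S = lookup X
    termwise : ∀ u → D * (⟦ S u ⟧ * nonDegree G S u) ≤ m * ∣ X ∣ * ⟦ S u ⟧
    termwise u with S u in Xu
    ... | true = subst₂ _≤_ (cong (D *_) (sym (+-identityʳ _))) (sym (*-identityʳ (m * ∣ X ∣)))
      (few-non-neighbours D (nonDegree G S u) (degreeIn X u) ∣ X ∣ (m * ∣ X ∣)
        (nonDegree-degreeIn G X u Xu) (dense u Xu))
    ... | false = ≤-trans (≤-reflexive (*-zeroʳ D)) z≤n

  -- Shrink X to a t-set S with no larger proportion of
  -- missing pairs; S then has at most m/4 non-adjacent pairs, and each of
  -- them has enough common neighbours to be routed through its own one.
  dense⇒subdivision : ∀ t → 1 ≤ t → MinDegree → (X : Subset m) → 20 * t ≤ 11 * ∣ X ∣ → Dense t X →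
    Subdivision G t
  dense⇒subdivision (suc zero) _ _ X big _ =
    single-vertex G (some-vertex (≤-trans (*-cancelˡ-≤ 11 (≤-trans (m≤m+n 11 9) big)) (∣p∣≤n X)))
  dense⇒subdivision t@(suc t′@(suc _)) _ minDeg X big dense = subst (Subdivision G) ∣L∣≡t (R.subdivision enough)
    where
    n = ∣ X ∣
    t≤n : t ≤ n
    t≤n = *-cancelˡ-≤ 20 (≤-trans big (*-monoˡ-≤ n (m≤m+n 11 9)))
    shrunk = sparse-subset G t′ (n ∸ t) (n * (n ∸ 1)) (missing G (lookup X)) (lookup X)
      (trans (sym (size-Subset X)) (sym (m+[n∸m]≡n t≤n)))
      (≤-reflexive (cong (λ s → missing G (lookup X) * (s * (s ∸ 1))) (size-Subset X)))
    S = proj₁ shrunk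
    L = elements S
    ∣L∣≡t : length L ≡ t
    ∣L∣≡t = trans (length-elements S) (proj₁ (proj₂ shrunk))
    module R = Routing G L (elements-unique S)
    few-pairs : 4 * length R.toRoute ≤ m
    few-pairs = few-missing-pairs t n (length R.toRoute) (missing G S) (missing G (lookup X)) m (s≤s (s≤s z≤n)) t≤n
      (≤-trans R.toRoute-count (≤-reflexive (missing-elements G S)))
      (proj₂ (proj₂ shrunk)) (dense⇒few-missing t X dense)
    enough : ∀ {q} → q ∈ R.toRoute → length R.toRoute + length L ≤ R.commonOf q
    enough {i , j} q∈ = subst (λ k → length R.toRoute + k ≤ R.commonOf (i , j)) (sym ∣L∣≡t)
      (room-for-paths (length R.toRoute) t n m _ few-pairs big (∣p∣≤n X)
        (common-large G minDeg _ _ (proj₂ (R.toRoute-sound q∈))))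

  sparse-vertex : ∀ t → 1 ≤ t → ¬ Subdivision G t → MinDegree → (X : Subset m) → 20 * t ≤ 11 * ∣ X ∣ →
    ∃[ v ] (lookup X v ≡ true × 2 * (t * t) * degreeIn X v + m * ∣ X ∣ ≤ 2 * (t * t) * ∣ X ∣)
  sparse-vertex t 1≤t noSub minDeg X big
    with any? (λ v → (lookup X v ≟ᵇ true) ×-dec (2 * (t * t) * degreeIn X v + m * ∣ X ∣ ≤? 2 * (t * t) * ∣ X ∣))
  ... | yes found = found
  ... | no none = contradiction (dense⇒subdivision t 1≤t minDeg X big λ v Xv → ≰⇒> λ sparse → none (v , Xv , sparse)) noSub

  -- Applied to the whole vertex set: either m ≤ 20t/11, or some vertex has
  -- degree at most (1 - m/(2t²)) m, which with degree ≥ 9m/10 gives m ≤ t²/5.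
  order-bound-ℕ : ∀ t → 1 ≤ t → ¬ Subdivision G t → MinDegree → 11 * m ≤ 20 * t ⊎ 5 * m ≤ t * t
  order-bound-ℕ t 1≤t noSub minDeg with 11 * m ≤? 20 * t
  ... | yes small = inj₁ small
  ... | no large = inj₂ (order-bound (t * t) m (degree v) m>0 (minDeg v) sparse)
    where
    in-V = sparse-vertex t 1≤t noSub minDeg ⊤ (subst (λ k → 20 * t ≤ 11 * k) (sym (∣⊤∣≡n m)) (<⇒≤ (≰⇒> large)))
    v = proj₁ in-V
    sparse : 2 * (t * t) * degree v + m * m ≤ 2 * (t * t) * m
    sparse = subst₂ _≤_ (cong₂ (λ d k → 2 * (t * t) * d + m * k) (cong ∣_∣ (∩-identityˡ (Graph.N G v))) (∣⊤∣≡n m))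
      (cong (2 * (t * t) *_) (∣⊤∣≡n m)) (proj₂ (proj₂ in-V))
    m>0 : 0 < m
    m>0 = n≢0⇒n>0 λ { refl → large z≤n }

order-bound-ℚ : ∀ m t → 11 * m ≤ 20 * t ⊎ 5 * m ≤ t * t →
  (m over 1) ≤ℚ (((20 * t) over 11) ⊔ ((t * t) over 5))
order-bound-ℚ m t (inj₁ small) = ℚ.p≤q⇒p≤q⊔r ((t * t) over 5) (over-≤⇐ m (20 * t) 10 small)
order-bound-ℚ m t (inj₂ large) = ℚ.p≤q⇒p≤r⊔q ((20 * t) over 11) (over-≤⇐ m (t * t) 4 large)

locally-sparse : ∀ {m} (G : Graph m) t′ → ¬ Subdivision G (suc t′) → MinDegree G →
  LocallySparse G (1ℚ - (m over (2 * (suc t′ * suc t′)))) ((20 * suc t′) over 11)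
locally-sparse {m} G t′ noSub minDeg X big
  with sparse-vertex G (suc t′) (s≤s z≤n) noSub minDeg X (over-≤⇒ (20 * suc t′) ∣ X ∣ 10 big)
... | v , Xv , sparse = v , lookup⇒[]= v X Xv , ≤-one-minus-fraction (Graph.degreeIn G X v) ∣ X ∣ m _ sparse

lemma4 : (t m : ℕ) → 1 ≤ t → (G : Graph m) → ¬ HasSubdivision G t →
    (∀ (v : Fin m) → (9 * m) over 10 ≤ℚ (Graph.degree G v over 1)) →
    ((m over 1) ≤ℚ (((20 * t) over 11) ⊔ ((t * t) over 5)))
    × LocallySparse G (1ℚ - (m over (2 * (t * t)))) ((20 * t) over 11)
lemma4 t@(suc t′) m 1≤t G noSub minDegreeℚ =
  order-bound-ℚ m t (order-bound-ℕ G t 1≤t noSub minDeg) , locally-sparse G t′ noSub minDeg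
  where
  minDeg : MinDegree G
  minDeg v = over-≤⇒ (9 * m) (Graph.degree G v) 9 (minDegreeℚ v)
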